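{- Let $q$ be a power of an odd prime, let $\lambda\in\mathbb{F}_q$ be a non-square, and let $f\in\mathbb{F}_q[X]$ be a permutation polynomial of $\mathbb{F}_q$. Consider the digraph $\mathcal{G}(\lambda,f)$. If $f(0)\neq 0$, then the vertex $0$ has in-degree $1$ and out-degree $2$, the vertex $f^{ -1}(0)$ has in-degree $2$ and out-degree $1$, and every other vertex $x$ (with $x\neq 0$ and $x\neq f^{ -1}(0)$) has in-degree $2$ and out-degree $2$. If $f(0)=0$, then the vertex $0$ has in-degree $1$ and out-degree $1$, and every vertex $x\neq 0$ has in-degree $2$ and out-degree $2$.
   Context: For a polynomial $f\in\mathbb{F}_q[X]$ and a non-square $\lambda\in\mathbb{F}_q$, $\mathcal{G}(\lambda,f)$ is the directed graph whose vertex set is $\mathbb{F}_q$, with an edge from $x$ to $y$ if and only if $(y^2-f(x))(\lambda y^2-f(x))=0$; loops are allowed. $f^{ -1}(0)$ denotes the unique preimage of $0$ under the bijection $x\mapsto f(x)$. -}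

module Defs where

open import Level using (_⊔_)
open import Algebra.Bundles using (CommutativeRing)
open import Data.Nat using (ℕ)
open import Data.Fin using (Fin)
open import Data.List using (List; []; _∷_; map; filter; length; allFin)
open import Data.Product using (_×_; ∃)
open import Relation.Nullary using (¬_; Dec)
open import Relation.Binary.Definitions using (Decidable)
open import Function.Bundles using (Bijection)
open import Function.Definitions using (Bijective)
import Relation.Binary.PropositionalEquality as ≡

module FieldDefs {c ℓ} (R : CommutativeRing c ℓ) where
  open CommutativeRing R

  IsField : Set (c ⊔ ℓ)
  IsField = (¬ (1# ≈ 0#)) × (∀ x → ¬ (x ≈ 0#) → ∃ λ y → x * y ≈ 1#)

  -- Polynomials in R[X] as coefficient lists, constant term first.
  Poly : Set c
  Poly = List Carrier

  eval : Poly → Carrier → Carrier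
  eval []       x = 0#
  eval (a ∷ as) x = a + x * eval as x

  IsPermutationPolynomial : Poly → Set (c ⊔ ℓ)
  IsPermutationPolynomial f = Bijective _≈_ _≈_ (eval f)

  IsNonSquare : Carrier → Set (c ⊔ ℓ)
  IsNonSquare l = ¬ (∃ λ a → a * a ≈ l)

  Edge : Carrier → Poly → Carrier → Carrier → Set ℓ
  Edge l f x y = ((y * y - eval f x) * (l * (y * y) - eval f x)) ≈ 0#

  module Degrees (_≟_ : Decidable _≈_) {q : ℕ}
                 (enum : Bijection (≡.setoid (Fin q)) setoid) where

    elements : List Carrier
    elements = map (Bijection.to enum) (allFin q)

    edge? : ∀ l f x y → Dec (Edge l f x y)
    edge? l f x y = _≟_ ((y * y - eval f x) * (l * (y * y) - eval f x)) 0#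

    outDegree : Carrier → Poly → Carrier → ℕ
    outDegree l f x = length (filter (edge? l f x) elements)

    inDegree : Carrier → Poly → Carrier → ℕ
    inDegree l f y = length (filter (λ x → edge? l f x y) elements)

-- The in-neighbours of y are f⁻¹(y²) and f⁻¹(l y²); they coincide exactly when y = 0,
-- since y² = l t² with t ≠ 0 would make l a square. For out-degrees only upper bounds are
-- immediate: the out-neighbours of x are the y with y² = f(x) or l y² = f(x), which is just
-- y = 0 when f(x) = 0 and at most ±t otherwise. Instead of showing that every non-zero
-- element is a square or l times a square, compare totals: out-degrees and in-degrees both
-- sum to the number of edges, the in-degrees sum to 2q − 1, and so do the upper bounds on
-- the out-degrees, hence every bound is attained.

module Submission where

open import Defs
open import Algebra.Bundles using (CommutativeRing)
open import Data.Nat using (ℕ; _^_)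
open import Data.Nat.Primality using (Prime)
open import Data.Fin using (Fin)
open import Data.Product using (_×_; _,_)
open import Relation.Nullary using (¬_)
open import Relation.Binary.Definitions using (Decidable)
open import Relation.Binary.PropositionalEquality using (_≡_; _≢_; setoid)
open import Function.Bundles using (Bijection)

module Counting where

  open import Data.Nat using (zero; suc; _+_; _≤_; z≤n; s≤s)
  open import Data.Nat.Properties using (+-mono-≤; +-0-commutativeMonoid; ≤-antisym; +-cancelˡ-≡; +-cancelʳ-≤; +-monoʳ-≤; module ≤-Reasoning)
  open import Data.Fin using (zero; suc; punchIn; _≟_)
  open import Data.Fin.Properties using (punchInᵢ≢i)
  open import Data.List using (filter; length; tabulate)
  open import Data.Sum using (_⊎_; inj₁; inj₂)
  open import Function using (_∘_)
  open import Relation.Nullary using (Dec; yes; no; contradiction)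
  open import Relation.Unary as U using (Pred)
  open import Relation.Binary.PropositionalEquality using (refl; sym; trans; cong; cong₂; module ≡-Reasoning)
  open import Algebra.Properties.CommutativeMonoid.Sum +-0-commutativeMonoid
    using (sum-syntax; sum-remove; sum-cong-≗; sum-replicate-zero; ∑-distrib-+; ∑-comm) public

  indicator : ∀ {p} {P : Set p} → Dec P → ℕ
  indicator (yes _) = 1
  indicator (no _)  = 0

  indicator-yes : ∀ {p} {P : Set p} (d : Dec P) → P → indicator d ≡ 1
  indicator-yes (yes _) _ = refl
  indicator-yes (no ¬P) P = contradiction P ¬P

  indicator-⊎ : ∀ {p q r} {P : Set p} {Q : Set q} {R : Set r} (d : Dec P) (e : Dec Q) (f : Dec R) →
                (P → Q ⊎ R) → indicator d ≤ indicator e + indicator f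
  indicator-⊎ (no _)  _       _       _ = z≤n
  indicator-⊎ (yes _) (yes _) _       _ = s≤s z≤n
  indicator-⊎ (yes _) (no _)  (yes _) _ = s≤s z≤n
  indicator-⊎ (yes p) (no ¬q) (no ¬r) P⇒Q⊎R with P⇒Q⊎R p
  ... | inj₁ q = contradiction q ¬q
  ... | inj₂ r = contradiction r ¬r

  indicator-⊎-disjoint : ∀ {p q r} {P : Set p} {Q : Set q} {R : Set r} (d : Dec P) (e : Dec Q) (f : Dec R) →
                         (P → Q ⊎ R) → (Q ⊎ R → P) → (Q → ¬ R) → indicator d ≡ indicator e + indicator f
  indicator-⊎-disjoint (yes _) (yes q) (yes r) _ _ Q⇒¬R = contradiction r (Q⇒¬R q)
  indicator-⊎-disjoint (yes _) (yes _) (no _)  _ _ _ = refl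
  indicator-⊎-disjoint (yes _) (no _)  (yes _) _ _ _ = refl
  indicator-⊎-disjoint (yes p) (no ¬q) (no ¬r) P⇒Q⊎R _ _ with P⇒Q⊎R p
  ... | inj₁ q = contradiction q ¬q
  ... | inj₂ r = contradiction r ¬r
  indicator-⊎-disjoint (no ¬p) (yes q) _       _ Q⊎R⇒P _ = contradiction (Q⊎R⇒P (inj₁ q)) ¬p
  indicator-⊎-disjoint (no ¬p) (no _)  (yes r) _ Q⊎R⇒P _ = contradiction (Q⊎R⇒P (inj₂ r)) ¬p
  indicator-⊎-disjoint (no _)  (no _)  (no _)  _ _ _ = refl

  oneOrTwo : ∀ {p} {P : Set p} → Dec P → ℕ
  oneOrTwo (yes _) = 1
  oneOrTwo (no _)  = 2

  oneOrTwo-no : ∀ {p} {P : Set p} (d : Dec P) → ¬ P → oneOrTwo d ≡ 2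
  oneOrTwo-no (yes P) ¬P = contradiction P ¬P
  oneOrTwo-no (no _)  _  = refl

  oneOrTwo+indicator : ∀ {p} {P : Set p} (d : Dec P) → oneOrTwo d + indicator d ≡ 2
  oneOrTwo+indicator (yes _) = refl
  oneOrTwo+indicator (no _)  = refl

  count-tabulate : ∀ {a p} {A : Set a} {P : Pred A p} (P? : U.Decidable P) {n} (g : Fin n → A) →
                   length (filter P? (tabulate g)) ≡ ∑[ i < n ] indicator (P? (g i))
  count-tabulate P? {zero}  g = refl
  count-tabulate P? {suc n} g with P? (g zero)
  ... | yes _ = cong suc (count-tabulate P? (g ∘ suc))
  ... | no  _ = count-tabulate P? (g ∘ suc)

  ∑-mono-≤ : ∀ {n} {f g : Fin n → ℕ} → (∀ i → f i ≤ g i) → ∑[ i < n ] f i ≤ ∑[ i < n ] g i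
  ∑-mono-≤ {zero}  f≤g = z≤n
  ∑-mono-≤ {suc n} f≤g = +-mono-≤ (f≤g zero) (∑-mono-≤ (f≤g ∘ suc))

  pointwise-≤∧∑≡⇒≡ : ∀ {n} {f g : Fin n → ℕ} → (∀ i → f i ≤ g i) →
                     ∑[ i < n ] f i ≡ ∑[ i < n ] g i → ∀ i → f i ≡ g i
  pointwise-≤∧∑≡⇒≡ {suc n} {f} {g} f≤g ∑f≡∑g = go
    where
    head≡ : f zero ≡ g zero
    head≡ = ≤-antisym (f≤g zero) (+-cancelʳ-≤ _ _ _ (begin
      g zero + ∑[ i < n ] f (suc i) ≤⟨ +-monoʳ-≤ (g zero) (∑-mono-≤ (f≤g ∘ suc)) ⟩
      g zero + ∑[ i < n ] g (suc i) ≡⟨ sym ∑f≡∑g ⟩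
      f zero + ∑[ i < n ] f (suc i) ∎))
      where open ≤-Reasoning
    go : ∀ i → f i ≡ g i
    go zero    = head≡
    go (suc i) = pointwise-≤∧∑≡⇒≡ (f≤g ∘ suc) (+-cancelˡ-≡ (f zero) _ _ (trans ∑f≡∑g (cong (_+ _) (sym head≡)))) i

  ∑-indicator-empty : ∀ {n p} {P : Pred (Fin n) p} (P? : U.Decidable P) →
                      (∀ i → ¬ P i) → ∑[ i < n ] indicator (P? i) ≡ 0
  ∑-indicator-empty {n} P? ¬P = trans (sum-cong-≗ zero-at) (sum-replicate-zero n)
    where
    zero-at : ∀ i → indicator (P? i) ≡ 0
    zero-at i with P? i
    ... | yes Pi = contradiction Pi (¬P i)
    ... | no  _  = refl

  ∑-indicator-single : ∀ {n p} {P : Pred (Fin n) p} (P? : U.Decidable P) {i} →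
                       P i → (∀ j → P j → j ≡ i) → ∑[ j < n ] indicator (P? j) ≡ 1
  ∑-indicator-single {suc n} P? {i} Pi only = begin
    ∑[ j < suc n ] indicator (P? j)                            ≡⟨ sum-remove {i = i} (indicator ∘ P?) ⟩
    indicator (P? i) + ∑[ j < n ] indicator (P? (punchIn i j)) ≡⟨ cong₂ _+_ (indicator-yes (P? i) Pi) rest≡0 ⟩
    1                                                          ∎
    where
    open ≡-Reasoning
    rest≡0 : ∑[ j < n ] indicator (P? (punchIn i j)) ≡ 0
    rest≡0 = ∑-indicator-empty (P? ∘ punchIn i) (λ j → punchInᵢ≢i i j ∘ only (punchIn i j))

  ∑-indicator-≟ : ∀ {n} (i : Fin n) → ∑[ j < n ] indicator (j ≟ i) ≡ 1
  ∑-indicator-≟ i = ∑-indicator-single (_≟ i) refl (λ _ j≡i → j≡i)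

  ∑-oneOrTwo-single : ∀ {n p} {P : Pred (Fin n) p} (P? : U.Decidable P) {i} →
                      P i → (∀ j → P j → j ≡ i) → ∑[ j < n ] oneOrTwo (P? j) + 1 ≡ ∑[ j < n ] 2
  ∑-oneOrTwo-single {n} P? Pi only = begin
    ∑[ j < n ] oneOrTwo (P? j) + 1                            ≡⟨ cong (∑[ j < n ] oneOrTwo (P? j) +_) (∑-indicator-single P? Pi only) ⟨
    ∑[ j < n ] oneOrTwo (P? j) + ∑[ j < n ] indicator (P? j)  ≡⟨ ∑-distrib-+ (oneOrTwo ∘ P?) (indicator ∘ P?) ⟨
    ∑[ j < n ] (oneOrTwo (P? j) + indicator (P? j))           ≡⟨ sum-cong-≗ (oneOrTwo+indicator ∘ P?) ⟩
    ∑[ j < n ] 2                                              ∎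
    where open ≡-Reasoning

  module _ {n p} {P : Pred (Fin n) p} (P? : U.Decidable P) {i k : Fin n} where

    ∑-indicator-pair : i ≢ k → P i → P k → (∀ j → P j → j ≡ i ⊎ j ≡ k) → ∑[ j < n ] indicator (P? j) ≡ 2
    ∑-indicator-pair i≢k Pi Pk only = begin
      ∑[ j < n ] indicator (P? j)                                 ≡⟨ sum-cong-≗ split ⟩
      ∑[ j < n ] (indicator (j ≟ i) + indicator (j ≟ k))          ≡⟨ ∑-distrib-+ (indicator ∘ (_≟ i)) (indicator ∘ (_≟ k)) ⟩
      ∑[ j < n ] indicator (j ≟ i) + ∑[ j < n ] indicator (j ≟ k) ≡⟨ cong₂ _+_ (∑-indicator-≟ i) (∑-indicator-≟ k) ⟩
      2                                                           ∎
      where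
      open ≡-Reasoning
      split : ∀ j → indicator (P? j) ≡ indicator (j ≟ i) + indicator (j ≟ k)
      split j = indicator-⊎-disjoint (P? j) (j ≟ i) (j ≟ k) (only j)
                  (λ { (inj₁ refl) → Pi ; (inj₂ refl) → Pk }) (λ { refl j≡k → i≢k j≡k })

    ∑-indicator-≤2 : (∀ j → P j → j ≡ i ⊎ j ≡ k) → ∑[ j < n ] indicator (P? j) ≤ 2
    ∑-indicator-≤2 only = begin
      ∑[ j < n ] indicator (P? j)                                 ≤⟨ ∑-mono-≤ (λ j → indicator-⊎ (P? j) (j ≟ i) (j ≟ k) (only j)) ⟩
      ∑[ j < n ] (indicator (j ≟ i) + indicator (j ≟ k))          ≡⟨ ∑-distrib-+ (indicator ∘ (_≟ i)) (indicator ∘ (_≟ k)) ⟩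
      ∑[ j < n ] indicator (j ≟ i) + ∑[ j < n ] indicator (j ≟ k) ≡⟨ cong₂ _+_ (∑-indicator-≟ i) (∑-indicator-≟ k) ⟩
      2                                                           ∎
      where open ≤-Reasoning

module Evaluation {c ℓ} (R : CommutativeRing c ℓ) where
  open CommutativeRing R
  open FieldDefs R
  open import Data.List using ([]; _∷_)

  eval-cong : ∀ g {x y} → x ≈ y → eval g x ≈ eval g y
  eval-cong []      x≈y = refl
  eval-cong (a ∷ g) x≈y = +-cong refl (*-cong x≈y (eval-cong g x≈y))

module FieldProperties {c ℓ} (F : CommutativeRing c ℓ) (isField : FieldDefs.IsField F)
                       (_≟_ : Decidable (CommutativeRing._≈_ F)) where
  open CommutativeRing F
  open FieldDefs F
  open import Data.Product using (proj₂)
  open import Data.Sum using (_⊎_; inj₁; inj₂; reduce)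
  open import Relation.Nullary using (yes; no; contradiction)
  open import Algebra.Properties.Ring ring using (x[y-z]≈xy-xz)
  open import Algebra.Properties.AbelianGroup +-abelianGroup using (x∙y⁻¹≈ε⇒x≈y; x≈y⇒x∙y⁻¹≈ε; inverseˡ-unique)
  open import Algebra.Properties.CommutativeSemigroup *-commutativeSemigroup using (interchange)
  open import Relation.Binary.Reasoning.Setoid (CommutativeRing.setoid F)

  *-cancelˡ : ∀ {w x y} → ¬ w ≈ 0# → w * x ≈ w * y → x ≈ y
  *-cancelˡ {w} {x} {y} w≉0 wx≈wy with proj₂ isField w w≉0
  ... | w⁻¹ , ww⁻¹≈1 = begin
    x                ≈⟨ *-identityˡ x ⟨
    1# * x           ≈⟨ *-congʳ (trans (sym ww⁻¹≈1) (*-comm w w⁻¹)) ⟩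
    w⁻¹ * w * x      ≈⟨ *-assoc w⁻¹ w x ⟩
    w⁻¹ * (w * x)    ≈⟨ *-congˡ wx≈wy ⟩
    w⁻¹ * (w * y)    ≈⟨ *-assoc w⁻¹ w y ⟨
    w⁻¹ * w * y      ≈⟨ *-congʳ (trans (*-comm w⁻¹ w) ww⁻¹≈1) ⟩
    1# * y           ≈⟨ *-identityˡ y ⟩
    y                ∎

  x*y≈0⇒x≈0⊎y≈0 : ∀ {x y} → x * y ≈ 0# → x ≈ 0# ⊎ y ≈ 0#
  x*y≈0⇒x≈0⊎y≈0 {x} {y} xy≈0 with x ≟ 0#
  ... | yes x≈0 = inj₁ x≈0
  ... | no  x≉0 = inj₂ (*-cancelˡ x≉0 (trans xy≈0 (sym (zeroʳ x))))

  x*x≈0⇒x≈0 : ∀ {x} → x * x ≈ 0# → x ≈ 0#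
  x*x≈0⇒x≈0 xx≈0 = reduce (x*y≈0⇒x≈0⊎y≈0 xx≈0)

  difference-of-squares : ∀ x y → (x - y) * (x + y) ≈ x * x - y * y
  difference-of-squares x y = begin
    (x - y) * (x + y)                  ≈⟨ distribˡ (x - y) x y ⟩
    (x - y) * x + (x - y) * y          ≈⟨ +-cong (*-comm (x - y) x) (*-comm (x - y) y) ⟩
    x * (x - y) + y * (x - y)          ≈⟨ +-cong (x[y-z]≈xy-xz x x y) (x[y-z]≈xy-xz y x y) ⟩
    (x * x - x * y) + (y * x - y * y)  ≈⟨ +-congˡ (+-congʳ (*-comm y x)) ⟩
    (x * x - x * y) + (x * y - y * y)  ≈⟨ +-assoc (x * x) (- (x * y)) _ ⟩
    x * x + (- (x * y) + (x * y - y * y)) ≈⟨ +-congˡ (+-assoc (- (x * y)) (x * y) _) ⟨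
    x * x + ((- (x * y) + x * y) - y * y) ≈⟨ +-congˡ (+-congʳ (-‿inverseˡ (x * y))) ⟩
    x * x + (0# - y * y)               ≈⟨ +-congˡ (+-identityˡ _) ⟩
    x * x - y * y                      ∎

  x*x≈y*y⇒x≈±y : ∀ {x y} → x * x ≈ y * y → x ≈ y ⊎ x ≈ - y
  x*x≈y*y⇒x≈±y {x} {y} xx≈yy with x*y≈0⇒x≈0⊎y≈0 (trans (difference-of-squares x y) (x≈y⇒x∙y⁻¹≈ε xx≈yy))
  ... | inj₁ x-y≈0 = inj₁ (x∙y⁻¹≈ε⇒x≈y x y x-y≈0)
  ... | inj₂ x+y≈0 = inj₂ (inverseˡ-unique x y x+y≈0)

  module NonSquare {l : Carrier} (nonSquare : IsNonSquare l) where

    nonSquare≉0 : ¬ l ≈ 0#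
    nonSquare≉0 l≈0 = nonSquare (0# , trans (zeroˡ 0#) (sym l≈0))

    square≉nonSquare*square : ∀ {s t} → ¬ t ≈ 0# → ¬ s * s ≈ l * (t * t)
    square≉nonSquare*square {s} {t} t≉0 ss≈ltt with proj₂ isField t t≉0
    ... | t⁻¹ , tt⁻¹≈1 = nonSquare (s * t⁻¹ , (begin
      (s * t⁻¹) * (s * t⁻¹)        ≈⟨ interchange s t⁻¹ s t⁻¹ ⟩
      (s * s) * (t⁻¹ * t⁻¹)        ≈⟨ *-congʳ ss≈ltt ⟩
      (l * (t * t)) * (t⁻¹ * t⁻¹)  ≈⟨ *-assoc l (t * t) (t⁻¹ * t⁻¹) ⟩
      l * ((t * t) * (t⁻¹ * t⁻¹))  ≈⟨ *-congˡ (interchange t t t⁻¹ t⁻¹) ⟩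
      l * ((t * t⁻¹) * (t * t⁻¹))  ≈⟨ *-congˡ (*-cong tt⁻¹≈1 tt⁻¹≈1) ⟩
      l * (1# * 1#)                ≈⟨ *-congˡ (*-identityˡ 1#) ⟩
      l * 1#                       ≈⟨ *-identityʳ l ⟩
      l                            ∎))

    RootOf : Carrier → Carrier → Set ℓ
    RootOf a y = y * y ≈ a ⊎ l * (y * y) ≈ a

    RootOf-resp : ∀ {a a′ y y′} → a ≈ a′ → y ≈ y′ → RootOf a y → RootOf a′ y′
    RootOf-resp a≈a′ y≈y′ (inj₁ yy≈a)  = inj₁ (trans (*-cong (sym y≈y′) (sym y≈y′)) (trans yy≈a a≈a′))
    RootOf-resp a≈a′ y≈y′ (inj₂ lyy≈a) = inj₂ (trans (*-congˡ (*-cong (sym y≈y′) (sym y≈y′))) (trans lyy≈a a≈a′))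

    Edge⇒RootOf : ∀ f x y → Edge l f x y → RootOf (eval f x) y
    Edge⇒RootOf f x y e with x*y≈0⇒x≈0⊎y≈0 e
    ... | inj₁ yy-a≈0  = inj₁ (x∙y⁻¹≈ε⇒x≈y _ _ yy-a≈0)
    ... | inj₂ lyy-a≈0 = inj₂ (x∙y⁻¹≈ε⇒x≈y _ _ lyy-a≈0)

    RootOf⇒Edge : ∀ f x y → RootOf (eval f x) y → Edge l f x y
    RootOf⇒Edge f x y (inj₁ yy≈a)  = trans (*-congʳ (x≈y⇒x∙y⁻¹≈ε yy≈a)) (zeroˡ _)
    RootOf⇒Edge f x y (inj₂ lyy≈a) = trans (*-congˡ (x≈y⇒x∙y⁻¹≈ε lyy≈a)) (zeroʳ _)

    RootOf[0,0] : RootOf 0# 0#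
    RootOf[0,0] = inj₁ (zeroˡ 0#)

    RootOf[a,0]⇒a≈0 : ∀ {a} → RootOf a 0# → a ≈ 0#
    RootOf[a,0]⇒a≈0 (inj₁ 00≈a)  = trans (sym 00≈a) (zeroˡ 0#)
    RootOf[a,0]⇒a≈0 (inj₂ l00≈a) = trans (sym l00≈a) (trans (*-congˡ (zeroˡ 0#)) (zeroʳ l))

    RootOf[0,y]⇒y≈0 : ∀ {y} → RootOf 0# y → y ≈ 0#
    RootOf[0,y]⇒y≈0 (inj₁ yy≈0) = x*x≈0⇒x≈0 yy≈0
    RootOf[0,y]⇒y≈0 (inj₂ lyy≈0) with x*y≈0⇒x≈0⊎y≈0 lyy≈0
    ... | inj₁ l≈0  = contradiction l≈0 nonSquare≉0
    ... | inj₂ yy≈0 = x*x≈0⇒x≈0 yy≈0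

    RootOf-≉0 : ∀ {a y} → ¬ a ≈ 0# → RootOf a y → ¬ y ≈ 0#
    RootOf-≉0 a≉0 root y≈0 = a≉0 (RootOf[a,0]⇒a≈0 (RootOf-resp refl y≈0 root))

    RootOf-± : ∀ {a t y} → ¬ a ≈ 0# → RootOf a t → RootOf a y → y ≈ t ⊎ y ≈ - t
    RootOf-± a≉0 (inj₁ tt≈a)  (inj₁ yy≈a)  = x*x≈y*y⇒x≈±y (trans yy≈a (sym tt≈a))
    RootOf-± a≉0 (inj₂ ltt≈a) (inj₂ lyy≈a) = x*x≈y*y⇒x≈±y (*-cancelˡ nonSquare≉0 (trans lyy≈a (sym ltt≈a)))
    RootOf-± a≉0 (inj₁ tt≈a)  (inj₂ lyy≈a) =
      contradiction (trans tt≈a (sym lyy≈a)) (square≉nonSquare*square (RootOf-≉0 a≉0 (inj₂ lyy≈a)))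
    RootOf-± a≉0 (inj₂ ltt≈a) (inj₁ yy≈a)  =
      contradiction (trans yy≈a (sym ltt≈a)) (square≉nonSquare*square (RootOf-≉0 a≉0 (inj₂ ltt≈a)))

module DigraphDegrees {c ℓ} (F : CommutativeRing c ℓ) (isField : FieldDefs.IsField F)
    (_≟_ : Decidable (CommutativeRing._≈_ F))
    {q : ℕ} (enum : Bijection (setoid (Fin q)) (CommutativeRing.setoid F))
    {l : CommutativeRing.Carrier F} (nonSquare : FieldDefs.IsNonSquare F l)
    (f : FieldDefs.Poly F) (perm : FieldDefs.IsPermutationPolynomial F f) where

  open CommutativeRing F using (Carrier; _≈_; _*_; -_; 0#; refl; sym; trans)
  open FieldDefs F
  open Evaluation F
  open Degrees _≟_ enum
  open FieldProperties F isField _≟_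
  open NonSquare nonSquare
  open Counting
  open import Data.Nat using (_+_; _≤_; z≤n)
  open import Data.Nat.Properties using (+-cancelʳ-≡; ≤-reflexive)
  open import Data.Fin.Properties using (any?)
  open import Data.List using (filter; length; tabulate)
  open import Data.List.Properties using (map-tabulate; filter-≐)
  open import Data.Product using (_,_; proj₁; proj₂)
  open import Data.Sum using (_⊎_; inj₁; inj₂)
  open import Function using (_∘_; id)
  open import Relation.Nullary using (yes; no; contradiction)
  import Relation.Binary.PropositionalEquality as ≡

  element : Fin q → Carrier
  element = Bijection.to enum

  index : Carrier → Fin q
  index x = proj₁ (Bijection.surjective enum x)

  element-index : ∀ x → element (index x) ≈ x
  element-index x = proj₂ (Bijection.surjective enum x) ≡.refl

  index-unique : ∀ {j x} → element j ≈ x → j ≡ index x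
  index-unique ej≈x = Bijection.injective enum (trans ej≈x (sym (element-index _)))

  eval-injective : ∀ {x y} → eval f x ≈ eval f y → x ≈ y
  eval-injective = proj₁ perm

  preimage : Carrier → Carrier
  preimage a = proj₁ (proj₂ perm a)

  eval-preimage : ∀ a → eval f (preimage a) ≈ a
  eval-preimage a = proj₂ (proj₂ perm a) refl

  preimageIndex : Carrier → Fin q
  preimageIndex = index ∘ preimage

  eval-preimageIndex : ∀ a → eval f (element (preimageIndex a)) ≈ a
  eval-preimageIndex a = trans (eval-cong f (element-index (preimage a))) (eval-preimage a)

  preimageIndex-unique : ∀ {j a} → eval f (element j) ≈ a → j ≡ preimageIndex a
  preimageIndex-unique fej≈a = index-unique (eval-injective (trans fej≈a (sym (eval-preimage _))))

  preimageIndex-injective : ∀ {a b} → preimageIndex a ≡ preimageIndex b → a ≈ b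
  preimageIndex-injective {a} {b} e =
    trans (sym (eval-preimageIndex a)) (≡.subst (λ i → eval f (element i) ≈ b) (≡.sym e) (eval-preimageIndex b))

  elements≡tabulate : elements ≡ tabulate element
  elements≡tabulate = map-tabulate id element

  outDegree-∑ : ∀ x → outDegree l f x ≡ ∑[ j < q ] indicator (edge? l f x (element j))
  outDegree-∑ x = ≡.trans (≡.cong (length ∘ filter (edge? l f x)) elements≡tabulate)
                          (count-tabulate (edge? l f x) element)

  inDegree-∑ : ∀ y → inDegree l f y ≡ ∑[ i < q ] indicator (edge? l f (element i) y)
  inDegree-∑ y = ≡.trans (≡.cong (length ∘ filter (λ x → edge? l f x y)) elements≡tabulate)
                         (count-tabulate (λ x → edge? l f x y) element)

  inDegree-0 : ∀ {y} → y ≈ 0# → inDegree l f y ≡ 1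
  inDegree-0 {y} y≈0 = ≡.trans (inDegree-∑ y) (∑-indicator-single (λ i → edge? l f (element i) y) edge only)
    where
    edge : Edge l f (element (preimageIndex 0#)) y
    edge = RootOf⇒Edge f _ y (RootOf-resp (sym (eval-preimageIndex 0#)) (sym y≈0) RootOf[0,0])
    only : ∀ j → Edge l f (element j) y → j ≡ preimageIndex 0#
    only j e = preimageIndex-unique (RootOf[a,0]⇒a≈0 (RootOf-resp refl y≈0 (Edge⇒RootOf f (element j) y e)))

  inDegree-≉0 : ∀ {y} → ¬ y ≈ 0# → inDegree l f y ≡ 2
  inDegree-≉0 {y} y≉0 = ≡.trans (inDegree-∑ y)
    (∑-indicator-pair (λ i → edge? l f (element i) y) distinct
      (RootOf⇒Edge f _ y (inj₁ (sym (eval-preimageIndex (y * y)))))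
      (RootOf⇒Edge f _ y (inj₂ (sym (eval-preimageIndex (l * (y * y))))))
      only)
    where
    distinct : preimageIndex (y * y) ≢ preimageIndex (l * (y * y))
    distinct = square≉nonSquare*square y≉0 ∘ preimageIndex-injective
    only : ∀ j → Edge l f (element j) y → j ≡ preimageIndex (y * y) ⊎ j ≡ preimageIndex (l * (y * y))
    only j e with Edge⇒RootOf f (element j) y e
    ... | inj₁ yy≈fej  = inj₁ (preimageIndex-unique (sym yy≈fej))
    ... | inj₂ lyy≈fej = inj₂ (preimageIndex-unique (sym lyy≈fej))

  inDegree≡oneOrTwo : ∀ y → inDegree l f y ≡ oneOrTwo (y ≟ 0#)
  inDegree≡oneOrTwo y with y ≟ 0#
  ... | yes y≈0 = inDegree-0 y≈0
  ... | no  y≉0 = inDegree-≉0 y≉0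

  outDegree-root : ∀ {x} → eval f x ≈ 0# → outDegree l f x ≡ 1
  outDegree-root {x} fx≈0 = ≡.trans (outDegree-∑ x) (∑-indicator-single (edge? l f x ∘ element) edge only)
    where
    edge : Edge l f x (element (index 0#))
    edge = RootOf⇒Edge f x _ (RootOf-resp (sym fx≈0) (sym (element-index 0#)) RootOf[0,0])
    only : ∀ j → Edge l f x (element j) → j ≡ index 0#
    only j e = index-unique (RootOf[0,y]⇒y≈0 (RootOf-resp fx≈0 refl (Edge⇒RootOf f x (element j) e)))

  outDegree-≤2 : ∀ {x} → ¬ eval f x ≈ 0# → outDegree l f x ≤ 2
  outDegree-≤2 {x} fx≉0 = ≡.subst (_≤ 2) (≡.sym (outDegree-∑ x)) bound
    where
    bound : ∑[ j < q ] indicator (edge? l f x (element j)) ≤ 2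
    bound with any? (edge? l f x ∘ element)
    ... | no none = ≡.subst (_≤ 2) (≡.sym (∑-indicator-empty _ (λ j e → none (j , e)))) z≤n
    ... | yes (k , e) = ∑-indicator-≤2 (edge? l f x ∘ element) only
      where
      only : ∀ j → Edge l f x (element j) → j ≡ k ⊎ j ≡ index (- element k)
      only j e′ with RootOf-± fx≉0 (Edge⇒RootOf f x (element k) e) (Edge⇒RootOf f x (element j) e′)
      ... | inj₁ ej≈ek  = inj₁ (Bijection.injective enum ej≈ek)
      ... | inj₂ ej≈-ek = inj₂ (index-unique ej≈-ek)

  outDegree≤oneOrTwo : ∀ x → outDegree l f x ≤ oneOrTwo (x ≟ preimage 0#)
  outDegree≤oneOrTwo x with x ≟ preimage 0#
  ... | yes x≈x₀ = ≤-reflexive (outDegree-root (trans (eval-cong f x≈x₀) (eval-preimage 0#)))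
  ... | no  x≉x₀ = outDegree-≤2 (λ fx≈0 → x≉x₀ (eval-injective (trans fx≈0 (sym (eval-preimage 0#)))))

  ∑-outDegree≡∑-inDegree : ∑[ i < q ] outDegree l f (element i) ≡ ∑[ j < q ] inDegree l f (element j)
  ∑-outDegree≡∑-inDegree = begin
    ∑[ i < q ] outDegree l f (element i)                                  ≡⟨ sum-cong-≗ (outDegree-∑ ∘ element) ⟩
    ∑[ i < q ] ∑[ j < q ] indicator (edge? l f (element i) (element j))  ≡⟨ ∑-comm (λ i j → indicator (edge? l f (element i) (element j))) ⟩
    ∑[ j < q ] ∑[ i < q ] indicator (edge? l f (element i) (element j))  ≡⟨ sum-cong-≗ (inDegree-∑ ∘ element) ⟨
    ∑[ j < q ] inDegree l f (element j)                                   ∎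
    where open ≡.≡-Reasoning

  ∑-oneOrTwo-≟ : ∀ c → ∑[ i < q ] oneOrTwo (element i ≟ c) + 1 ≡ ∑[ i < q ] 2
  ∑-oneOrTwo-≟ c = ∑-oneOrTwo-single (λ i → element i ≟ c) (element-index c) (λ _ → index-unique)

  -- Both sums of bounds are 2q − 1, as exactly one vertex gets the bound 1.
  ∑-outDegree≡∑-oneOrTwo : ∑[ i < q ] outDegree l f (element i) ≡ ∑[ i < q ] oneOrTwo (element i ≟ preimage 0#)
  ∑-outDegree≡∑-oneOrTwo = begin
    ∑[ i < q ] outDegree l f (element i)          ≡⟨ ∑-outDegree≡∑-inDegree ⟩
    ∑[ i < q ] inDegree l f (element i)           ≡⟨ sum-cong-≗ (inDegree≡oneOrTwo ∘ element) ⟩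
    ∑[ i < q ] oneOrTwo (element i ≟ 0#)          ≡⟨ +-cancelʳ-≡ 1 _ _ (≡.trans (∑-oneOrTwo-≟ 0#) (≡.sym (∑-oneOrTwo-≟ (preimage 0#)))) ⟩
    ∑[ i < q ] oneOrTwo (element i ≟ preimage 0#) ∎
    where open ≡.≡-Reasoning

  outDegree-cong : ∀ {x x′} → x ≈ x′ → outDegree l f x ≡ outDegree l f x′
  outDegree-cong {x} {x′} x≈x′ =
    ≡.cong length (filter-≐ (edge? l f x) (edge? l f x′) (resp x≈x′ , resp (sym x≈x′)) elements)
    where
    resp : ∀ {u v y} → u ≈ v → Edge l f u y → Edge l f v y
    resp {u} {v} {y} u≈v e = RootOf⇒Edge f v y (RootOf-resp (eval-cong f u≈v) refl (Edge⇒RootOf f u y e))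

  outDegree-nonroot : ∀ {x} → ¬ eval f x ≈ 0# → outDegree l f x ≡ 2
  outDegree-nonroot {x} fx≉0 = begin
    outDegree l f x                                  ≡⟨ outDegree-cong (element-index x) ⟨
    outDegree l f (element (index x))                ≡⟨ tight (index x) ⟩
    oneOrTwo (element (index x) ≟ preimage 0#)       ≡⟨ oneOrTwo-no (element (index x) ≟ preimage 0#) ex≉x₀ ⟩
    2                                                ∎
    where
    open ≡.≡-Reasoning
    tight : ∀ i → outDegree l f (element i) ≡ oneOrTwo (element i ≟ preimage 0#)
    tight = pointwise-≤∧∑≡⇒≡ (outDegree≤oneOrTwo ∘ element) ∑-outDegree≡∑-oneOrTwo
    ex≉x₀ : ¬ element (index x) ≈ preimage 0#
    ex≉x₀ ex≈x₀ = fx≉0 (trans (eval-cong f (trans (sym (element-index x)) ex≈x₀)) (eval-preimage 0#))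

proposition2p1 : ∀ {c ℓ} (F : CommutativeRing c ℓ) → FieldDefs.IsField F
  → (_≟_ : Decidable (CommutativeRing._≈_ F))
  → (q : ℕ) (enum : Bijection (setoid (Fin q)) (CommutativeRing.setoid F))
  → (p k : ℕ) → Prime p → p ≢ 2 → q ≡ p ^ k
  → (l : CommutativeRing.Carrier F) → FieldDefs.IsNonSquare F l
  → (f : FieldDefs.Poly F) → FieldDefs.IsPermutationPolynomial F f
  → let open CommutativeRing F
        open FieldDefs F
        open Degrees _≟_ enum
    in (¬ (eval f 0# ≈ 0#) →
          (inDegree l f 0# ≡ 1 × outDegree l f 0# ≡ 2)
          × (∀ x → eval f x ≈ 0# → inDegree l f x ≡ 2 × outDegree l f x ≡ 1)
          × (∀ x → ¬ (x ≈ 0#) → ¬ (eval f x ≈ 0#) → inDegree l f x ≡ 2 × outDegree l f x ≡ 2))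
       × (eval f 0# ≈ 0# →
          (inDegree l f 0# ≡ 1 × outDegree l f 0# ≡ 1)
          × (∀ x → ¬ (x ≈ 0#) → inDegree l f x ≡ 2 × outDegree l f x ≡ 2))
proposition2p1 F isField _≟_ q enum _ _ _ _ _ l nonSquare f perm =
    (λ f0≉0 → (inDegree-0 refl , outDegree-nonroot f0≉0)
            , (λ x fx≈0 → inDegree-≉0 (λ x≈0 → f0≉0 (trans (eval-cong f (sym x≈0)) fx≈0)) , outDegree-root fx≈0)
            , (λ x x≉0 fx≉0 → inDegree-≉0 x≉0 , outDegree-nonroot fx≉0))
  , (λ f0≈0 → (inDegree-0 refl , outDegree-root f0≈0)
            , (λ x x≉0 → inDegree-≉0 x≉0 , outDegree-nonroot (λ fx≈0 → x≉0 (eval-injective (trans fx≈0 (sym f0≈0))))))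
  where
  open CommutativeRing F using (refl; sym; trans)
  open Evaluation F
  open DigraphDegrees F isField _≟_ enum nonSquare f perm
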